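{- For every $\varepsilon>0$ there is a positive integer $m$ such that every $m$-free digraph $G$ contains a vertex $v$ with $d^{++}(v)\geq (1-\varepsilon)\, d^+(v)$.
   Context: All digraphs are finite, simple (no loops, no multiple arcs) and digonless (for any two vertices $u,v$, at most one of the arcs $uv$, $vu$ is present). For a vertex $v$, $d^+(v)$ is the number of out-neighbors of $v$, and $d^{++}(v)$ is the number of vertices at (directed) distance exactly $2$ from $v$. A digraph is called $m$-free if it contains no directed cycle of length at most $m$.
   Formalization: The parameter ε ranges over the positive rationals. -}

module Defs where

open import Data.Nat using (ℕ; zero; suc; _+_; _≤_; NonZero)
open import Data.Nat.DivMod using (_mod_)
open import Data.Fin using (Fin; toℕ; _≟_)
open import Data.Fin.Properties using ()
open import Data.Bool using (Bool; true; false; _∧_; not)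
open import Data.List using (List; length; filterᵇ; allFin)
open import Data.Bool.ListAction using (any)
open import Data.Product using (Σ; _×_)
open import Relation.Nullary using (¬_)
open import Relation.Nullary.Decidable using (⌊_⌋)
open import Relation.Binary.PropositionalEquality using (_≡_)
open import Function.Definitions using (Injective)

record Digraph (n : ℕ) : Set where
  field
    arc        : Fin n → Fin n → Bool
    loopless   : ∀ v → arc v v ≡ false
    digonless  : ∀ u v → arc u v ≡ true → arc v u ≡ false

open Digraph public

outdeg : ∀ {n} → Digraph n → Fin n → ℕ
outdeg {n} G v = length (filterᵇ (arc G v) (allFin n))

dist2ᵇ : ∀ {n} → Digraph n → Fin n → Fin n → Bool
dist2ᵇ {n} G v w =
  not ⌊ v ≟ w ⌋ ∧ not (arc G v w) ∧ any (λ u → arc G v u ∧ arc G u w) (allFin n)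

secondOutdeg : ∀ {n} → Digraph n → Fin n → ℕ
secondOutdeg {n} G v = length (filterᵇ (dist2ᵇ G v) (allFin n))

DirectedCycle : ∀ {n} → Digraph n → (k : ℕ) → .{{NonZero k}} → Set
DirectedCycle {n} G k =
  Σ (Fin k → Fin n) λ c →
    Injective _≡_ _≡_ c × (∀ (i : Fin k) → arc G (c i) (c ((suc (toℕ i)) mod k)) ≡ true)

MFree : ∀ {n} → ℕ → Digraph n → Set
MFree m G = ∀ (j : ℕ) → suc j ≤ m → ¬ DirectedCycle G (suc j)

module Submission where

-- Write ε = p/q with p ≥ 1 and take m = 3^q.  Let v be a vertex of minimum
-- out-degree δ and t = d⁺⁺(v).  An out-neighbour of v has at least δ
-- out-neighbours, and those outside N⁺(v) lie at distance 2 from v; so in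
-- the set N⁺(v), of size δ, every vertex has at least k = δ ∸ t
-- out-neighbours.  The shrinking lemma turns a non-empty vertex set of size
-- below q·k with this property into a closed walk of length at most 3^q:
-- repeatedly pick a vertex of in-degree ≥ k, delete its in-neighbours and
-- add two-step shortcut arcs, each realised by a walk at most three times
-- longer.  A closed walk contains a cycle no longer than itself, so
-- m-freeness forces q·k ≤ δ, which is (1 - ε)δ ≤ t after clearing
-- denominators.

open import Defs

module Counting where

  open import Data.Nat using (ℕ; zero; suc; _+_; _*_; _≤_; z≤n; s≤s)
  open import Data.Nat.Properties
  open import Algebra.Properties.CommutativeSemigroup +-commutativeSemigroup using (interchange)
  open import Data.Bool using (Bool; true; false; _∧_; _∨_; not)
  open import Data.Bool.Properties using (∧-conicalˡ; ∧-conicalʳ; ∨-zeroʳ; T-≡)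
  open import Data.Fin using (Fin)
  open import Data.List using (List; []; _∷_; length; filterᵇ; allFin)
  open import Data.List.Relation.Unary.Any using (here; there; satisfied)
  open import Data.List.Relation.Unary.Any.Properties using (any⁺; any⁻)
  open import Data.List.Membership.Propositional using (_∈_; lose)
  open import Data.List.Membership.Propositional.Properties using (∈-allFin)
  open import Data.Bool.ListAction using (any)
  open import Data.Product using (∃; _×_; _,_)
  open import Data.Sum using (_⊎_; inj₁; inj₂)
  open import Function using (Equivalence)
  open import Relation.Nullary using (contradiction)
  open import Relation.Binary.PropositionalEquality

  ∧-intro : ∀ {a b} → a ≡ true → b ≡ true → a ∧ b ≡ true
  ∧-intro refl refl = refl

  ∧-elim : ∀ {a b} → a ∧ b ≡ true → a ≡ true × b ≡ true
  ∧-elim {a} {b} h = ∧-conicalˡ a b h , ∧-conicalʳ a b h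

  ∨-elim : ∀ {a b} → a ∨ b ≡ true → a ≡ true ⊎ b ≡ true
  ∨-elim {true}  _ = inj₁ refl
  ∨-elim {false} h = inj₂ h

  ∨-introˡ : ∀ {a b} → a ≡ true → a ∨ b ≡ true
  ∨-introˡ refl = refl

  ∨-introʳ : ∀ {a b} → b ≡ true → a ∨ b ≡ true
  ∨-introʳ {a} refl = ∨-zeroʳ a

  not-intro : ∀ {a} → a ≡ false → not a ≡ true
  not-intro refl = refl

  any-intro : ∀ {n} (p : Fin n → Bool) x → p x ≡ true → any p (allFin n) ≡ true
  any-intro p x px =
    Equivalence.to T-≡ (any⁺ p (lose (∈-allFin x) (Equivalence.from T-≡ px)))

  any-witness : ∀ {n} (p : Fin n → Bool) → any p (allFin n) ≡ true → ∃ λ x → p x ≡ true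
  any-witness {n} p h with satisfied (any⁻ p (allFin n) (Equivalence.from T-≡ h))
  ... | x , px = x , Equivalence.to T-≡ px

  count : {A : Set} → (A → Bool) → List A → ℕ
  count p xs = length (filterᵇ p xs)

  indicator : Bool → ℕ
  indicator true  = 1
  indicator false = 0

  ∑ : {A : Set} → List A → (A → ℕ) → ℕ
  ∑ []       f = 0
  ∑ (x ∷ xs) f = f x + ∑ xs f

  private
    variable
      A C : Set

  count-∷ : ∀ (p : A → Bool) x xs → count p (x ∷ xs) ≡ indicator (p x) + count p xs
  count-∷ p x xs with p x
  ... | true  = refl
  ... | false = refl

  count-false : ∀ (xs : List A) → count (λ _ → false) xs ≡ 0
  count-false []       = refl
  count-false (x ∷ xs) = count-false xs

  count-mono : ∀ (p q : A → Bool) → (∀ x → p x ≡ true → q x ≡ true) →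
               ∀ xs → count p xs ≤ count q xs
  count-mono p q p⊆q []       = z≤n
  count-mono p q p⊆q (x ∷ xs) with p x in px | q x in qx
  ... | true  | true  = s≤s (count-mono p q p⊆q xs)
  ... | true  | false = contradiction (trans (sym (p⊆q x px)) qx) λ ()
  ... | false | true  = m≤n⇒m≤1+n (count-mono p q p⊆q xs)
  ... | false | false = count-mono p q p⊆q xs

  count-pos : ∀ (p : A → Bool) {x xs} → x ∈ xs → p x ≡ true → 1 ≤ count p xs
  count-pos p {x} {_ ∷ xs} (here refl) px rewrite count-∷ p x xs | px = s≤s z≤n
  count-pos p {_} {y ∷ xs} (there x∈xs) px =
    ≤-trans (count-pos p x∈xs px) (≤-trans (m≤n+m _ _) (≤-reflexive (sym (count-∷ p y xs))))

  count-split : ∀ (p q : A → Bool) xs →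
                count p xs ≡ count (λ x → p x ∧ q x) xs + count (λ x → p x ∧ not (q x)) xs
  count-split p q []       = refl
  count-split p q (x ∷ xs) with p x | q x
  ... | false | _     = count-split p q xs
  ... | true  | true  = cong suc (count-split p q xs)
  ... | true  | false = trans (cong suc (count-split p q xs)) (sym (+-suc _ _))

  ∑-+ : ∀ xs (f g : A → ℕ) → ∑ xs (λ x → f x + g x) ≡ ∑ xs f + ∑ xs g
  ∑-+ []       f g = refl
  ∑-+ (x ∷ xs) f g =
    trans (cong (f x + g x +_) (∑-+ xs f g)) (interchange (f x) (g x) (∑ xs f) (∑ xs g))

  ∑-cong : ∀ xs {f g : A → ℕ} → (∀ x → f x ≡ g x) → ∑ xs f ≡ ∑ xs g
  ∑-cong []       f≗g = refl
  ∑-cong (x ∷ xs) f≗g = cong₂ _+_ (f≗g x) (∑-cong xs f≗g)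

  ∑-indicator : ∀ xs (p : A → Bool) → ∑ xs (λ x → indicator (p x)) ≡ count p xs
  ∑-indicator []       p = refl
  ∑-indicator (x ∷ xs) p = trans (cong (indicator (p x) +_) (∑-indicator xs p)) (sym (count-∷ p x xs))

  double-counting : ∀ (B : A → C → Bool) xs ys →
                    ∑ xs (λ x → count (B x) ys) ≡ ∑ ys (λ y → count (λ x → B x y) xs)
  double-counting B xs []       = count-false-rows xs
    where
    count-false-rows : ∀ xs → ∑ xs (λ x → count (B x) []) ≡ 0
    count-false-rows []       = refl
    count-false-rows (x ∷ xs) = count-false-rows xs
  double-counting B xs (y ∷ ys) = begin
      ∑ xs (λ x → count (B x) (y ∷ ys))
    ≡⟨ ∑-cong xs (λ x → count-∷ (B x) y ys) ⟩
      ∑ xs (λ x → indicator (B x y) + count (B x) ys)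
    ≡⟨ ∑-+ xs _ _ ⟩
      ∑ xs (λ x → indicator (B x y)) + ∑ xs (λ x → count (B x) ys)
    ≡⟨ cong₂ _+_ (∑-indicator xs (λ x → B x y)) (double-counting B xs ys) ⟩
      count (λ x → B x y) xs + ∑ ys (λ y → count (λ x → B x y) xs)
    ∎
    where open ≡-Reasoning

  ∑-lower : ∀ (p : A → Bool) (f : A → ℕ) {k} → (∀ x → p x ≡ true → k ≤ f x) →
            ∀ xs → count p xs * k ≤ ∑ xs f
  ∑-lower p f k≤f []       = z≤n
  ∑-lower p f k≤f (x ∷ xs) with p x in px
  ... | true  = +-mono-≤ (k≤f x px) (∑-lower p f k≤f xs)
  ... | false = ≤-trans (∑-lower p f k≤f xs) (m≤n+m _ (f x))

  ∑-upper : ∀ (p : A → Bool) (f : A → ℕ) {k} → (∀ x → p x ≡ true → f x ≤ k) →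
            (∀ x → p x ≡ false → f x ≡ 0) → ∀ xs → ∑ xs f ≤ count p xs * k
  ∑-upper p f f≤k f≡0 []       = z≤n
  ∑-upper p f f≤k f≡0 (x ∷ xs) with p x in px
  ... | true  = +-mono-≤ (f≤k x px) (∑-upper p f f≤k f≡0 xs)
  ... | false rewrite f≡0 x px = ∑-upper p f f≤k f≡0 xs

module Walks {n} (G : Digraph n) where

  open import Data.Nat using (ℕ; zero; suc; _+_; _≤_; _<_; s≤s)
  open import Data.Nat.Properties hiding (_≟_)
  open import Data.Nat.DivMod using (_mod_; _%_; m<n⇒m%n≡m; n%n≡0; m%n<n)
  open import Data.Fin using (Fin; toℕ; fromℕ<; _≟_)
  open import Data.Fin.Properties using (any?; toℕ<n; toℕ-fromℕ<; toℕ-injective)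
  open import Data.Bool using (true)
  open import Data.Product using (Σ; ∃; _×_; _,_)
  open import Data.Sum using (_⊎_; inj₁; inj₂)
  open import Data.Empty using (⊥-elim)
  open import Relation.Nullary using (yes; no)
  open import Relation.Binary.Definitions using (tri<; tri≈; tri>)
  open import Relation.Binary.PropositionalEquality


  data Walk : Fin n → Fin n → ℕ → Set where
    []  : ∀ {x} → Walk x x 0
    _∷_ : ∀ {x y z ℓ} → arc G x y ≡ true → Walk y z ℓ → Walk x z (suc ℓ)

  _++_ : ∀ {x y z a b} → Walk x y a → Walk y z b → Walk x z (a + b)
  []      ++ q = q
  (e ∷ p) ++ q = e ∷ (p ++ q)

  ShortWalk : ℕ → Fin n → Fin n → Set
  ShortWalk L x y = Σ ℕ λ ℓ → 1 ≤ ℓ × ℓ ≤ L × Walk x y ℓ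

  arc-walk : ∀ {x y} → arc G x y ≡ true → ShortWalk 1 x y
  arc-walk e = 1 , ≤-refl , ≤-refl , (e ∷ [])

  weaken : ∀ {L L′ x y} → L ≤ L′ → ShortWalk L x y → ShortWalk L′ x y
  weaken L≤L′ (ℓ , 1≤ℓ , ℓ≤L , p) = ℓ , 1≤ℓ , ≤-trans ℓ≤L L≤L′ , p

  concat : ∀ {A B x y z} → ShortWalk A x y → ShortWalk B y z → ShortWalk (A + B) x z
  concat (a , 1≤a , a≤A , p) (b , _ , b≤B , q) =
    a + b , ≤-trans 1≤a (m≤m+n a b) , +-mono-≤ a≤A b≤B , p ++ q

  Traces : (ℕ → Fin n) → ℕ → Set
  Traces f ℓ = ∀ i → i < ℓ → arc G (f i) (f (suc i)) ≡ true

  Distinct : (ℕ → Fin n) → ℕ → Set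
  Distinct f ℓ = ∀ {a b} → a < b → b < ℓ → f a ≢ f b

  distinct⇒cycle : ∀ f d → Traces f (suc d) → f (suc d) ≡ f 0 → Distinct f (suc d) →
                   DirectedCycle G (suc d)
  distinct⇒cycle f d trace closed distinct = c , injective , arcs
    where
    c : Fin (suc d) → Fin n
    c a = f (toℕ a)

    injective : ∀ {a b} → c a ≡ c b → a ≡ b
    injective {a} {b} eq with <-cmp (toℕ a) (toℕ b)
    ... | tri< a<b _ _ = ⊥-elim (distinct a<b (toℕ<n b) eq)
    ... | tri≈ _ a≡b _ = toℕ-injective a≡b
    ... | tri> _ _ b<a = ⊥-elim (distinct b<a (toℕ<n a) (sym eq))

    next : ∀ (a : Fin (suc d)) → c (suc (toℕ a) mod suc d) ≡ f (suc (toℕ a))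
    next a with m<1+n⇒m<n∨m≡n (s≤s (toℕ<n a))
    ... | inj₁ a+1<d+1 = cong f (trans (toℕ-fromℕ< (m%n<n (suc (toℕ a)) (suc d))) (m<n⇒m%n≡m a+1<d+1))
    ... | inj₂ a+1≡d+1 = begin
      f (toℕ (suc (toℕ a) mod suc d)) ≡⟨ cong f (toℕ-fromℕ< (m%n<n (suc (toℕ a)) (suc d))) ⟩
      f (suc (toℕ a) % suc d)          ≡⟨ cong (λ m → f (m % suc d)) a+1≡d+1 ⟩
      f (suc d % suc d)                ≡⟨ cong f (n%n≡0 (suc d)) ⟩
      f 0                              ≡⟨ closed ⟨
      f (suc d)                        ≡⟨ cong f a+1≡d+1 ⟨
      f (suc (toℕ a))                  ∎
      where open ≡-Reasoning

    arcs : ∀ (a : Fin (suc d)) → arc G (c a) (c (suc (toℕ a) mod suc d)) ≡ true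
    arcs a rewrite next a = trace (toℕ a) (toℕ<n a)

  FirstRepetition : (ℕ → Fin n) → ℕ → Set
  FirstRepetition f ℓ = Σ ℕ λ j → j < ℓ × Distinct f j × ∃ λ i → i < j × f i ≡ f j

  first-repetition : ∀ f ℓ → Distinct f ℓ ⊎ FirstRepetition f ℓ
  first-repetition f zero = inj₁ λ _ ()
  first-repetition f (suc ℓ) with first-repetition f ℓ
  ... | inj₂ (j , j<ℓ , rest) = inj₂ (j , m<n⇒m<1+n j<ℓ , rest)
  ... | inj₁ distinct with any? (λ (i : Fin ℓ) → f (toℕ i) ≟ f ℓ)
  ...   | yes (i , fi≡fℓ) = inj₂ (ℓ , ≤-refl , distinct , toℕ i , toℕ<n i , fi≡fℓ)
  ...   | no no-earlier = inj₁ extended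
    where
    extended : Distinct f (suc ℓ)
    extended {a} {b} a<b b<ℓ+1 with m<1+n⇒m<n∨m≡n b<ℓ+1
    ... | inj₁ b<ℓ  = distinct a<b b<ℓ
    ... | inj₂ refl = λ fa≡fℓ →
      no-earlier (fromℕ< a<b , subst (λ m → f m ≡ f ℓ) (sym (toℕ-fromℕ< a<b)) fa≡fℓ)

  -- Every closed trace of positive length contains a directed cycle that is
  -- no longer: the segment between a first repetition.
  closed-trace⇒cycle : ∀ f ℓ → 1 ≤ ℓ → Traces f ℓ → f ℓ ≡ f 0 →
                       Σ ℕ λ d → suc d ≤ ℓ × DirectedCycle G (suc d)
  closed-trace⇒cycle f ℓ 1≤ℓ trace closed with first-repetition f (suc ℓ)
  ... | inj₁ distinct = ⊥-elim (distinct 1≤ℓ ≤-refl (sym closed))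
  ... | inj₂ (j , s≤s j≤ℓ , distinct , i , i<j , fi≡fj) with m≤n⇒∃[o]m+o≡n i<j
  ...   | d , refl = d , ≤-trans (s≤s (m≤n+m d i)) j≤ℓ ,
                     distinct⇒cycle g d trace′ closed′ distinct′
    where
    g : ℕ → Fin n
    g k = f (i + k)

    trace′ : Traces g (suc d)
    trace′ k k<d+1 rewrite +-suc i k =
      trace (i + k) (≤-trans (+-monoʳ-< i k<d+1) (subst (_≤ ℓ) (sym (+-suc i d)) j≤ℓ))

    closed′ : g (suc d) ≡ g 0
    closed′ = trans (cong f (+-suc i d)) (trans (sym fi≡fj) (cong f (sym (+-identityʳ i))))

    distinct′ : Distinct g (suc d)
    distinct′ {a} {b} a<b b<d+1 = distinct (+-monoʳ-< i a<b) (subst (i + b <_) (+-suc i d) (+-monoʳ-< i b<d+1))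

  vertex : ∀ {x y ℓ} → Walk x y ℓ → ℕ → Fin n
  vertex {x} []      _       = x
  vertex {x} (_ ∷ p) zero    = x
  vertex     (_ ∷ p) (suc i) = vertex p i

  vertex-start : ∀ {x y ℓ} (p : Walk x y ℓ) → vertex p 0 ≡ x
  vertex-start []      = refl
  vertex-start (_ ∷ p) = refl

  vertex-end : ∀ {x y ℓ} (p : Walk x y ℓ) → vertex p ℓ ≡ y
  vertex-end []      = refl
  vertex-end (_ ∷ p) = vertex-end p

  vertex-traces : ∀ {x y ℓ} (p : Walk x y ℓ) → Traces (vertex p) ℓ
  vertex-traces (e ∷ p) zero    _         = subst (λ z → arc G _ z ≡ true) (sym (vertex-start p)) e
  vertex-traces (e ∷ p) (suc i) (s≤s i<ℓ) = vertex-traces p i i<ℓ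

  closed-walk⇒cycle : ∀ {L x} → ShortWalk L x x → Σ ℕ λ d → suc d ≤ L × DirectedCycle G (suc d)
  closed-walk⇒cycle (ℓ , 1≤ℓ , ℓ≤L , p) with closed-trace⇒cycle (vertex p) ℓ 1≤ℓ (vertex-traces p)
                                              (trans (vertex-end p) (sym (vertex-start p)))
  ... | d , d<ℓ , cycle = d , ≤-trans d<ℓ ℓ≤L , cycle

module DenseSubdigraphs where

  open import Data.Nat using (ℕ; zero; suc; _+_; _*_; _^_; _≤_; _<_; _≤?_; z≤n; s≤s; >-nonZero)
  open import Data.Nat.Properties hiding (_≟_)
  open import Data.Bool using (Bool; true; false; _∧_; _∨_; not)
  open import Data.Bool.Properties using (¬-not) renaming (_≟_ to _≟ᵇ_)
  open import Data.Fin using (Fin)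
  open import Data.Fin.Properties using (any?)
  open import Data.List using (allFin)
  open import Data.Bool.ListAction using (any)
  open import Data.List.Membership.Propositional.Properties using (∈-allFin)
  open import Data.Product using (∃; _×_; _,_; proj₁)
  open import Data.Sum using (inj₁; inj₂)
  open import Relation.Nullary using (yes; no; contradiction)
  open import Relation.Nullary.Decidable using (_×-dec_)
  open import Relation.Binary.PropositionalEquality
  open Counting

  m<n*k⇒0<k : ∀ {m} n k → m < n * k → 0 < k
  m<n*k⇒0<k {m} n zero    m<n*0 = contradiction (subst (m <_) (*-zeroʳ n) m<n*0) λ ()
  m<n*k⇒0<k n (suc k) _     = s≤s z≤n

  3L≤3^[1+j]L : ∀ j L → 3 * L ≤ 3 ^ suc j * L
  3L≤3^[1+j]L j L = *-monoˡ-≤ L (m≤m*n 3 (3 ^ j) {{m^n≢0 3 j}})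

  2L≤3^[1+j]L : ∀ j L → L + L ≤ 3 ^ suc j * L
  2L≤3^[1+j]L j L = ≤-trans (+-monoʳ-≤ L (m≤m+n L (L + 0))) (3L≤3^[1+j]L j L)

  L≤3^[1+j]L : ∀ j L → L ≤ 3 ^ suc j * L
  L≤3^[1+j]L j L = ≤-trans (m≤m+n L L) (2L≤3^[1+j]L j L)

  3^j[3L]≡3^[1+j]L : ∀ j L → 3 ^ j * (3 * L) ≡ 3 ^ suc j * L
  3^j[3L]≡3^[1+j]L j L = trans (sym (*-assoc (3 ^ j) 3 L)) (cong (_* L) (*-comm (3 ^ j) 3))

  module DenseSets {n : ℕ} where

    VertexSet = Fin n → Bool
    ArcRelation = Fin n → Fin n → Bool

    size : VertexSet → ℕ
    size S = count S (allFin n)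

    outdegIn : VertexSet → ArcRelation → Fin n → ℕ
    outdegIn S R x = count (λ y → S y ∧ R x y) (allFin n)

    indegIn : VertexSet → ArcRelation → Fin n → ℕ
    indegIn S R y = count (λ x → S x ∧ R x y) (allFin n)

    MinOutdeg : VertexSet → ArcRelation → ℕ → Set
    MinOutdeg S R k = ∀ x → S x ≡ true → k ≤ outdegIn S R x

    -- If every vertex of a non-empty S has k ≥ 1 out-neighbours in S, some
    -- vertex of S has k in-neighbours in S: double count the arcs inside S.
    high-indegree : ∀ S R {k} → 1 ≤ k → 1 ≤ size S → MinOutdeg S R k →
                    ∃ λ v → S v ≡ true × k ≤ indegIn S R v
    high-indegree S R {suc k} (s≤s z≤n) nonempty min-out
      with any? (λ v → (S v ≟ᵇ true) ×-dec (suc k ≤? indegIn S R v))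
    ... | yes found = found
    ... | no none   = contradiction (≤-trans lower upper) (<⇒≱ strict)
      where
      B : ArcRelation
      B x y = S y ∧ (S x ∧ R x y)

      rows : ∀ x → S x ≡ true → suc k ≤ count (B x) (allFin n)
      rows x sx = subst (λ b → suc k ≤ count (λ y → S y ∧ (b ∧ R x y)) (allFin n)) (sym sx) (min-out x sx)

      columns : ∀ y → S y ≡ true → count (λ x → B x y) (allFin n) ≤ k
      columns y sy rewrite sy = ≤-pred (≰⇒> λ k≤in → none (y , sy , k≤in))

      empty-columns : ∀ y → S y ≡ false → count (λ x → B x y) (allFin n) ≡ 0
      empty-columns y sy rewrite sy = count-false (allFin n)

      lower : size S * suc k ≤ ∑ (allFin n) (λ y → count (λ x → B x y) (allFin n))
      lower = subst (size S * suc k ≤_) (double-counting B (allFin n) (allFin n))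
                    (∑-lower S _ rows (allFin n))

      upper : ∑ (allFin n) (λ y → count (λ x → B x y) (allFin n)) ≤ size S * k
      upper = ∑-upper S _ columns empty-columns (allFin n)

      strict : size S * k < size S * suc k
      strict = *-monoʳ-< (size S) {{>-nonZero nonempty}} (n<1+n k)

  module Shrinking {n : ℕ} (G : Digraph n) where

    open DenseSets {n}
    open Walks G

    Realised : ArcRelation → ℕ → Set
    Realised R L = ∀ {x y} → R x y ≡ true → ShortWalk L x y

    L+[L+L]≡3L : ∀ L → L + (L + L) ≡ 3 * L
    L+[L+L]≡3L L = cong (λ m → L + (L + m)) (sym (+-identityʳ L))

    module Step (S : VertexSet) (R : ArcRelation) (v : Fin n) where

      S′ : VertexSet
      S′ y = S y ∧ not (R y v)

      feeds : Fin n → Bool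
      feeds w = any (λ u → R w u ∧ R u v) (allFin n)

      R′ : ArcRelation
      R′ w x = R w x ∨ (feeds w ∧ R v x)

      size-split : size S ≡ indegIn S R v + size S′
      size-split = count-split S (λ y → R y v) (allFin n)

      -- shortcuts are realised by three walks of length at most L
      realised′ : ∀ {L} → Realised R L → Realised R′ (3 * L)
      realised′ {L} realised {w} {x} e with ∨-elim e
      ... | inj₁ wx = weaken (m≤n*m L 3) (realised wx)
      ... | inj₂ fw∧vx with ∧-elim fw∧vx
      ...   | fw , vx with any-witness (λ u → R w u ∧ R u v) fw
      ...     | u , wu∧uv with ∧-elim wu∧uv
      ...       | wu , uv = weaken (≤-reflexive (L+[L+L]≡3L L))
                              (concat (realised wu) (concat (realised uv) (realised vx)))

      -- The out-degree condition survives: a vertex feeding v inherits the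
      -- out-neighbours of v, and any other vertex keeps its own, none of
      -- which is an in-neighbour of v.
      min-outdeg′ : ∀ {k} → S v ≡ true → (∀ x → R v x ≡ true → R x v ≡ false) →
                    MinOutdeg S R k → MinOutdeg S′ R′ k
      min-outdeg′ sv no-digon min-out w s′w with feeds w ≟ᵇ true
      ... | yes fw = ≤-trans (min-out v sv) (count-mono _ _ via-v (allFin n))
        where
        via-v : ∀ y → S y ∧ R v y ≡ true → S′ y ∧ R′ w y ≡ true
        via-v y h with ∧-elim h
        ... | sy , vy = ∧-intro (∧-intro sy (not-intro (no-digon y vy))) (∨-introʳ (∧-intro fw vy))
      ... | no ¬fw = ≤-trans (min-out w (proj₁ (∧-elim s′w))) (count-mono _ _ direct (allFin n))
        where
        direct : ∀ y → S y ∧ R w y ≡ true → S′ y ∧ R′ w y ≡ true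
        direct y h with ∧-elim h
        ... | sy , wy = ∧-intro (∧-intro sy (not-intro ¬yv)) (∨-introˡ wy)
          where
          ¬yv : R y v ≡ false
          ¬yv = ¬-not λ yv → ¬fw (any-intro (λ u → R w u ∧ R u v) y (∧-intro wy yv))

    -- Find v ∈ S with k R-in-neighbours; a loop or
    -- digon at v closes a walk, otherwise shrink around v, which removes at
    -- least k vertices while tripling the walk lengths.
    dense-set⇒closed-walk : ∀ j S R k L → Realised R L → 1 ≤ size S → size S < j * k →
                            MinOutdeg S R k → ∃ λ x → ShortWalk (3 ^ j * L) x x
    dense-set⇒closed-walk zero S R k L realised nonempty ()
    dense-set⇒closed-walk (suc j) S R k L realised nonempty small min-out
      with high-indegree S R (m<n*k⇒0<k (suc j) k small) nonempty min-out
    ... | v , sv , k≤in with R v v in vv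
    ...   | true = v , weaken (L≤3^[1+j]L j L) (realised vv)
    ...   | false with any? (λ x → (R v x ≟ᵇ true) ×-dec (R x v ≟ᵇ true))
    ...     | yes (x , vx , xv) =
                v , weaken (2L≤3^[1+j]L j L) (concat (realised vx) (realised xv))
    ...     | no no-digon = subst (λ B → ∃ λ x → ShortWalk B x x) (3^j[3L]≡3^[1+j]L j L)
                (dense-set⇒closed-walk j S′ R′ k (3 * L) (realised′ realised) nonempty′ small′
                   (min-outdeg′ sv (λ x vx → ¬-not λ xv → no-digon (x , vx , xv)) min-out))
      where
      open Step S R v
      nonempty′ : 1 ≤ size S′
      nonempty′ = count-pos S′ (∈-allFin v) (∧-intro sv (not-intro vv))
      small′ : size S′ < j * k
      small′ = +-cancelˡ-< k (size S′) (j * k)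
                 (≤-<-trans (+-monoˡ-≤ (size S′) k≤in) (subst (_< suc j * k) size-split small))

module MinimumOutdegree where

  open import Data.Nat using (ℕ; suc; _+_; _*_; _∸_; _^_; _≤_; _<_)
  open import Data.Nat.Properties hiding (_≟_)
  open import Data.Bool using (true; _∧_; not)
  open import Data.Bool.Properties using (∧-comm)
  open import Data.Fin using (Fin; zero; _≟_)
  open import Data.List using (allFin)
  open import Data.List.Extrema.Nat using (argmin; f[argmin]≤f[xs])
  import Data.List.Relation.Unary.All as All
  open import Data.List.Membership.Propositional.Properties using (∈-allFin)
  open import Data.Product using (Σ; ∃; _×_; _,_; proj₂)
  open import Relation.Nullary using (yes; no; contradiction)
  open import Relation.Binary.PropositionalEquality
  open Counting
  open DenseSubdigraphs

  min-outdeg-vertex : ∀ {n} (G : Digraph (suc n)) →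
                      Σ (Fin (suc n)) λ v → ∀ w → outdeg G v ≤ outdeg G w
  min-outdeg-vertex {n} G =
    argmin (outdeg G) zero (allFin (suc n)) ,
    λ w → All.lookup (f[argmin]≤f[xs] {f = outdeg G} zero (allFin (suc n))) (∈-allFin w)

  module AtVertex {n : ℕ} (G : Digraph n) (v : Fin n)
                  (minimal : ∀ w → outdeg G v ≤ outdeg G w) where

    open DenseSets {n}
    open Walks G
    open Shrinking G

    δ t : ℕ
    δ = outdeg G v
    t = secondOutdeg G v

    -- An out-neighbour a of v has at least δ out-neighbours; those outside
    -- N⁺(v) are at distance 2 from v (they differ from v, as G has no digon),
    -- so at least δ ∸ t of them lie in N⁺(v).
    neighbourhood-min-outdeg : MinOutdeg (arc G v) (arc G) (δ ∸ t)
    neighbourhood-min-outdeg a va = begin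
      δ ∸ t                                ≤⟨ ∸-monoˡ-≤ t (≤-trans (minimal a) split) ⟩
      outdegIn (arc G v) (arc G) a + t ∸ t ≡⟨ m+n∸n≡m _ t ⟩
      outdegIn (arc G v) (arc G) a         ∎
      where
      open ≤-Reasoning

      at-distance-2 : ∀ y → arc G a y ∧ not (arc G v y) ≡ true → dist2ᵇ G v y ≡ true
      at-distance-2 y h with ∧-elim h
      ... | ay , ¬vy with v ≟ y
      ...   | yes refl = contradiction (trans (sym ay) (digonless G v a va)) λ ()
      ...   | no _     = ∧-intro ¬vy (any-intro (λ u → arc G v u ∧ arc G u y) a (∧-intro va ay))

      inside : count (λ y → arc G a y ∧ arc G v y) (allFin n) ≤ outdegIn (arc G v) (arc G) a
      inside = count-mono _ _ (λ y → trans (∧-comm (arc G v y) (arc G a y))) (allFin n)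

      outside : count (λ y → arc G a y ∧ not (arc G v y)) (allFin n) ≤ t
      outside = count-mono _ _ at-distance-2 (allFin n)

      split : outdeg G a ≤ outdegIn (arc G v) (arc G) a + t
      split = begin
        outdeg G a                                               ≡⟨ count-split (arc G a) (arc G v) (allFin n) ⟩
        count (λ y → arc G a y ∧ arc G v y) (allFin n)
          + count (λ y → arc G a y ∧ not (arc G v y)) (allFin n) ≤⟨ +-mono-≤ inside outside ⟩
        outdegIn (arc G v) (arc G) a + t                         ∎

    short-cycle : ∀ q → δ < q * (δ ∸ t) → Σ ℕ λ d → suc d ≤ 3 ^ q × DirectedCycle G (suc d)
    short-cycle q small =
      closed-walk⇒cycle (weaken (≤-reflexive (*-identityʳ (3 ^ q))) (proj₂ closed-walk))
      where
      nonempty : 1 ≤ δ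
      nonempty = ≤-trans (m<n*k⇒0<k q (δ ∸ t) small) (m∸n≤m δ t)

      closed-walk : ∃ λ x → ShortWalk (3 ^ q * 1) x x
      closed-walk = dense-set⇒closed-walk q (arc G v) (arc G) (δ ∸ t) 1 arc-walk nonempty small
                                          neighbourhood-min-outdeg

    minimum-outdeg-bound : ∀ q → MFree (3 ^ q) G → q * (δ ∸ t) ≤ δ
    minimum-outdeg-bound q free = ≮⇒≥ λ small →
      let d , d<3^q , cycle = short-cycle q small in free d d<3^q cycle

module RationalBound where

  open import Data.Nat as ℕ using (ℕ; suc; NonZero)
  import Data.Nat.Properties as ℕ
  open import Data.Integer as ℤ using (ℤ; +_; +[1+_]; -[1+_])
  import Data.Integer.Properties as ℤ
  open import Data.Integer.Tactic.RingSolver using (solve-∀)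
  open import Data.Rational using (ℚ; mkℚ; _/_; _-_; -_; _*_; _≤_; _<_; 0ℚ; 1ℚ; toℚᵘ; ↧ₙ_; *<*)
  import Data.Rational.Properties as ℚ
  import Data.Rational.Unnormalised as ℚᵘ
  import Data.Rational.Unnormalised.Properties as ℚᵘ
  open import Relation.Binary.PropositionalEquality

  scaled-bound : ∀ q p δ t → .{{NonZero p}} →
                 q ℕ.* (δ ℕ.∸ t) ℕ.≤ δ → q ℕ.* δ ℕ.≤ q ℕ.* t ℕ.+ p ℕ.* δ
  scaled-bound q p δ t h = begin
    q ℕ.* δ                     ≤⟨ ℕ.*-monoʳ-≤ q (ℕ.m≤n+m∸n δ t) ⟩
    q ℕ.* (t ℕ.+ (δ ℕ.∸ t))     ≡⟨ ℕ.*-distribˡ-+ q t (δ ℕ.∸ t) ⟩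
    q ℕ.* t ℕ.+ q ℕ.* (δ ℕ.∸ t) ≤⟨ ℕ.+-monoʳ-≤ (q ℕ.* t) (ℕ.≤-trans h (ℕ.m≤n*m δ p)) ⟩
    q ℕ.* t ℕ.+ p ℕ.* δ         ∎
    where open ℕ.≤-Reasoning

  -- The same inequality over ℤ, rearranged into the shape in which ℚᵘ
  -- cross-multiplies (1 - P/Q) · D ≤ T.
  cross-multiplied : ∀ (Q P D T : ℤ) → Q ℤ.* D ℤ.≤ Q ℤ.* T ℤ.+ P ℤ.* D →
                     ((+ 1 ℤ.* Q ℤ.+ (ℤ.- P) ℤ.* + 1) ℤ.* D) ℤ.* + 1 ℤ.≤ T ℤ.* Q
  cross-multiplied Q P D T h = begin
    ((+ 1 ℤ.* Q ℤ.+ (ℤ.- P) ℤ.* + 1) ℤ.* D) ℤ.* + 1 ≡⟨ lhs Q P D ⟩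
    Q ℤ.* D ℤ.- P ℤ.* D                              ≤⟨ ℤ.+-monoˡ-≤ (ℤ.- (P ℤ.* D)) h ⟩
    Q ℤ.* T ℤ.+ P ℤ.* D ℤ.- P ℤ.* D                  ≡⟨ rhs Q P D T ⟩
    T ℤ.* Q                                          ∎
    where
    open ℤ.≤-Reasoning
    lhs : ∀ Q P D → ((+ 1 ℤ.* Q ℤ.+ (ℤ.- P) ℤ.* + 1) ℤ.* D) ℤ.* + 1 ≡ Q ℤ.* D ℤ.- P ℤ.* D
    lhs = solve-∀
    rhs : ∀ Q P D T → Q ℤ.* T ℤ.+ P ℤ.* D ℤ.- P ℤ.* D ≡ T ℤ.* Q
    rhs = solve-∀

  -- If q(δ ∸ t) ≤ δ, where q is the denominator of ε > 0, then (1 - ε)δ ≤ t: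
  -- the cross-multiplied form is qδ - pδ ≤ qt with p ≥ 1 the numerator.
  ε-bound : ∀ (ε : ℚ) → 0ℚ < ε → ∀ δ t → ↧ₙ ε ℕ.* (δ ℕ.∸ t) ℕ.≤ δ →
            (1ℚ - ε) * ((+ δ) / 1) ≤ (+ t) / 1
  ε-bound ε@(mkℚ +[1+ p ] d _) _ δ t h =
    ℚ.toℚᵘ-cancel-≤ (ℚᵘ.≤-respˡ-≃ (ℚᵘ.≃-sym lhs≃) (ℚᵘ.≤-respʳ-≃ (ℚᵘ.≃-sym rhs≃) (ℚᵘ.*≤* cross)))
    where
    q : ℕ
    q = suc d
    P : ℤ
    P = +[1+ p ]

    integral : + q ℤ.* + δ ℤ.≤ + q ℤ.* + t ℤ.+ P ℤ.* + δ
    integral = subst₂ ℤ._≤_ (ℤ.pos-* q δ)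
      (trans (ℤ.pos-+ (q ℕ.* t) (suc p ℕ.* δ)) (cong₂ ℤ._+_ (ℤ.pos-* q t) (ℤ.pos-* (suc p) δ)))
      (ℤ.+≤+ (scaled-bound q (suc p) δ t h))

    -- ℚᵘ writes the denominator of (1 - ε) · δ as (1 · q) · 1
    denominator : q ≡ (1 ℕ.* q) ℕ.* 1
    denominator = sym (trans (ℕ.*-identityʳ (1 ℕ.* q)) (ℕ.*-identityˡ q))

    cross : ((+ 1 ℤ.* + q ℤ.+ (ℤ.- P) ℤ.* + 1) ℤ.* + δ) ℤ.* + 1 ℤ.≤ + t ℤ.* + ((1 ℕ.* q) ℕ.* 1)
    cross = subst (λ m → ((+ 1 ℤ.* + q ℤ.+ (ℤ.- P) ℤ.* + 1) ℤ.* + δ) ℤ.* + 1 ℤ.≤ + t ℤ.* + m)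
                  denominator (cross-multiplied (+ q) P (+ δ) (+ t) integral)

    lhs≃ : toℚᵘ ((1ℚ - ε) * ((+ δ) / 1)) ℚᵘ.≃
           (ℚᵘ.1ℚᵘ ℚᵘ.+ ℚᵘ.mkℚᵘ -[1+ p ] d) ℚᵘ.* ℚᵘ.mkℚᵘ (+ δ) 0
    lhs≃ = ℚᵘ.≃-trans (ℚ.toℚᵘ-homo-* (1ℚ - ε) ((+ δ) / 1))
             (ℚᵘ.*-cong (ℚᵘ.≃-trans (ℚ.toℚᵘ-homo-+ 1ℚ (- ε))
                                    (ℚᵘ.+-congʳ ℚᵘ.1ℚᵘ (ℚ.toℚᵘ-homo‿- ε)))
                        (ℚ.toℚᵘ-fromℚᵘ (ℚᵘ.mkℚᵘ (+ δ) 0)))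

    rhs≃ : toℚᵘ ((+ t) / 1) ℚᵘ.≃ ℚᵘ.mkℚᵘ (+ t) 0
    rhs≃ = ℚ.toℚᵘ-fromℚᵘ (ℚᵘ.mkℚᵘ (+ t) 0)
  ε-bound (mkℚ (+ 0) d _)    (*<* (ℤ.+<+ ())) δ t h
  ε-bound (mkℚ -[1+ p ] d _) (*<* ())         δ t h

open MinimumOutdegree
open RationalBound

open import Data.Nat using (ℕ; suc; _^_; _≥_)
open import Data.Nat.Properties using (m^n>0)
open import Data.Fin using (Fin)
open import Data.Product using (Σ; ∃; _×_; _,_)
open import Data.Integer using (+_)
open import Data.Rational using (ℚ; _/_; _-_; _*_; _≤_; _<_; 0ℚ; 1ℚ; ↧ₙ_)

corollary1p3 : (ε : ℚ) → 0ℚ < ε →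
    Σ ℕ λ m → m ≥ 1 × ∀ (n : ℕ) (G : Digraph (suc n)) → MFree m G →
      ∃ λ (v : Fin (suc n)) →
        (1ℚ - ε) * ((+ outdeg G v) / 1) ≤ (+ secondOutdeg G v) / 1
corollary1p3 ε ε>0 = 3 ^ q , m^n>0 3 q , λ n G free →
  let v , minimal = min-outdeg-vertex G
      open AtVertex G v minimal
  in v , ε-bound ε ε>0 δ t (minimum-outdeg-bound q free)
  where
  q : ℕ
  q = ↧ₙ ε
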